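{- Let $n\ge 1$. Every placement of $n$ pairwise nonattacking kings on a $2\times 2n$ rectangle is equal to the arrangement $R(A,k)$ for exactly one pair $(A,k)$ with $A\subseteq[n]$ and $1\le k\le n+1$.
   Context: Kings occupy cells of a board; two kings attack each other if their cells are distinct and adjacent horizontally, vertically or diagonally. A $2\times 2n$ rectangle has a top and a bottom row and columns $1,\dots,2n$; it is partitioned into $n$ squares of size $2\times 2$, where square $j$ ($1\le j\le n$) consists of columns $2j-1$ (its left column) and $2j$ (its right column). For $A\subseteq[n]=\{1,\dots,n\}$ and $1\le k\le n+1$, $R(A,k)$ denotes the placement of $n$ kings on the rectangle having exactly one king in each square $j$, located in the top row of the square if $j\in A$ and in the bottom row otherwise, and in the left column of the square if $j<k$ and in the right column if $j\ge k$. (These $2^n(n+1)$ arrangements are the entries of a $2^n\times(n+1)$ matrix $M_{2n}$ with rows indexed by $A$ and columns by $k$.) -}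

module Defs where

open import Data.Nat using (ℕ; zero; suc; _+_; _*_; _<_; _≤_; _/_; _%_)
open import Data.Nat.Properties using (_<?_)
open import Data.Bool using (Bool; true; false; _∧_; if_then_else_)
open import Data.Fin using (Fin; toℕ)
open import Data.Fin.Subset using (Subset; _∈_)
open import Data.Vec using (Vec; lookup)
open import Data.Product using (_×_; _,_; Σ; proj₁; proj₂)
open import Data.Sum using (_⊎_)
open import Relation.Binary.PropositionalEquality using (_≡_; _≢_)
open import Relation.Nullary using (¬_)
open import Relation.Nullary.Decidable using (⌊_⌋)
open import Data.List using (List; length; filter)
import Data.List as L
open import Data.Fin using (Fin)

-- A cell of the 2 × 2n board: (row, column).
-- Row: true = top row, false = bottom row.
-- Column: Fin (2 * n), 0-based; paper's column c+1.
Cell : ℕ → Set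
Cell n = Bool × Fin (2 * n)

colNear : ℕ → ℕ → Set
colNear a b = (a ≡ b) ⊎ (suc a ≡ b) ⊎ (a ≡ suc b)

-- Two kings on cells x, y attack each other: distinct and adjacent
-- horizontally, vertically or diagonally (any two rows are adjacent, as
-- there are only 2 rows).
Attack : ∀ {n} → Cell n → Cell n → Set
Attack {n} x y = _≢_ {A = Cell n} x y × colNear (toℕ (proj₂ x)) (toℕ (proj₂ y))

Placement : ℕ → Set
Placement n = Cell n → Bool

allCells : (n : ℕ) → List (Cell n)
allCells n = L.cartesianProduct (true L.∷ false L.∷ L.[]) (L.allFin (2 * n))

numKings : ∀ {n} → Placement n → ℕ
numKings {n} P = length (L.filterᵇ P (allCells n))

NonAttacking : ∀ {n} → Placement n → Set
NonAttacking {n} P = ∀ (x y : Cell n) → P x ≡ true → P y ≡ true → ¬ Attack {n} x y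

ValidPlacement : ∀ n → Placement n → Set
ValidPlacement n P = numKings {n} P ≡ n × NonAttacking {n} P

-- A : Subset n, where position j0 (0-based) is square j = j0+1;
-- A j0 = inside means j ∈ A.  k : Fin (suc n) with toℕ k = paper's k - 1,
-- so paper's condition j < k  becomes  j0 < toℕ k.
-- The cell (r, c) (0-based column c) lies in square j0 = c / 2; it is the
-- left column of that square iff c % 2 = 0.
-- R(A,k) has a king at (r,c) iff  r = [j0 ∈ A]  and  (c is left ⇔ j0 < k).
R : ∀ {n} → Subset n → Fin (suc n) → Placement n
R {n} A k (r , c) = rowOk ∧ colOk
  where
  open import Data.Fin using (fromℕ<)
  c' = toℕ c
  j0 = c' / 2
  -- j0 < n always holds; the out-of-range branch is unreachable.
  inA : Bool
  inA with j0 <? n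
  ... | Relation.Nullary.yes p = lookup A (fromℕ< p)
  ... | Relation.Nullary.no _ = false
  rowOk = ⌊ r Data.Bool.≟ inA ⌋
  isLeft = ⌊ (c' % 2) Data.Nat.≟ 0 ⌋
  colOk = ⌊ isLeft Data.Bool.≟ ⌊ j0 <? toℕ k ⌋ ⌋

module Submission where

-- Split the board into its n squares of size 2 × 2.  The four cells of a square are pairwise
-- adjacent, so a nonattacking placement has at most one king per square; with n kings every
-- square holds exactly one, in row A_j and in the left or right column.  A king in the right
-- column of square j attacks a king in the left column of square j+1, so the squares whose
-- king is on the left form an initial segment {j < k}.  Conversely, the king of square j in
-- R(A,k) is at row A_j and in the column determined by j < k, so (A,k) is determined by R(A,k).

open import Defs
open import Data.Nat using (ℕ; zero; suc; _+_; _*_; _/_; _%_; _<_; _≤_; _≥_; _<ᵇ_; z≤n; s≤s)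
  renaming (_≟_ to _≟ℕ_)
open import Data.Nat.Properties
  using (_<?_; +-commutativeSemigroup; +-assoc; +-mono-≤; *-comm; *-monoˡ-≤; ≤-refl; ≤-trans; n≤1+n; 1+n≰n; 1+n≢n; suc-injective)
open import Algebra.Properties.CommutativeSemigroup +-commutativeSemigroup
  using () renaming (interchange to +-interchange)
open import Data.Nat.DivMod
  using (m≡m%n+[m/n]*n; m%n<n; m*n/n≡m; m*n%n≡0; [m+kn]%n≡m%n; +-distrib-/-∣ʳ; m<n*o⇒m/o<n)
open import Data.Nat.Divisibility using (n∣m*n)
open import Data.Bool using (Bool; true; false; _∧_; _∨_)
open import Data.Bool.Properties using (_≟_)
open import Data.Fin using (Fin; toℕ; fromℕ<) renaming (zero to fzero; suc to fsuc)
open import Data.Fin.Properties using (toℕ<n; toℕ-fromℕ<; fromℕ<-toℕ; fromℕ<-cong) renaming (_≟_ to _≟ᶠ_)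
open import Data.Fin.Subset using (Subset)
open import Data.Vec using (lookup; tabulate)
open import Data.Vec.Properties using (lookup∘tabulate)
open import Data.Vec.Relation.Binary.Pointwise.Extensional using (ext; Pointwise-≡⇒≡)
open import Data.List using (List; length; filterᵇ; map; _++_)
import Data.List as List
open import Data.List.Properties using (filter-++; length-++; ++-identityʳ; map-tabulate)
open import Data.Product using (Σ; Σ-syntax; _×_; _,_; proj₁; proj₂)
import Data.Product as Product
open import Data.Product.Properties using (≡-dec)
open import Data.Sum using (inj₁; inj₂)
open import Data.Empty using (⊥; ⊥-elim)
open import Function using (_∘_; id; case_of_)
open import Relation.Nullary using (yes; no; contradiction)
open import Relation.Nullary.Decidable using (⌊_⌋; T?; isYes≗does)
open import Relation.Binary.PropositionalEquality
  using (_≡_; _≢_; refl; sym; trans; cong; cong₂; subst; module ≡-Reasoning)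

bit : Bool → ℕ
bit true = 1
bit false = 0

≟-refl : ∀ x → ⌊ x ≟ x ⌋ ≡ true
≟-refl true = refl
≟-refl false = refl

≟-sound : ∀ x y → ⌊ x ≟ y ⌋ ≡ true → x ≡ y
≟-sound true true _ = refl
≟-sound false false _ = refl

∧-true⁻ : ∀ {x y} → x ∧ y ≡ true → x ≡ true × y ≡ true
∧-true⁻ {true} {true} _ = refl , refl

sumBelow : ℕ → (ℕ → ℕ) → ℕ
sumBelow zero f = 0
sumBelow (suc m) f = f 0 + sumBelow m (f ∘ suc)

sumBelow-+ : ∀ m f g → sumBelow m f + sumBelow m g ≡ sumBelow m (λ i → f i + g i)
sumBelow-+ zero f g = refl
sumBelow-+ (suc m) f g = begin
  (f 0 + sumBelow m (f ∘ suc)) + (g 0 + sumBelow m (g ∘ suc))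
    ≡⟨ +-interchange (f 0) _ (g 0) _ ⟩
  (f 0 + g 0) + (sumBelow m (f ∘ suc) + sumBelow m (g ∘ suc))
    ≡⟨ cong (f 0 + g 0 +_) (sumBelow-+ m (f ∘ suc) (g ∘ suc)) ⟩
  (f 0 + g 0) + sumBelow m (λ i → f (suc i) + g (suc i))
    ∎
  where open ≡-Reasoning

sumBelow-pairs : ∀ m g → sumBelow (m * 2) g ≡ sumBelow m (λ j → g (j * 2) + g (suc (j * 2)))
sumBelow-pairs zero g = refl
sumBelow-pairs (suc m) g =
  trans (sym (+-assoc (g 0) (g 1) _)) (cong (g 0 + g 1 +_) (sumBelow-pairs m (g ∘ suc ∘ suc)))

sumBelow-≤ : ∀ m f → (∀ j → f j ≤ 1) → sumBelow m f ≤ m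
sumBelow-≤ zero f _ = z≤n
sumBelow-≤ (suc m) f bounded = +-mono-≤ (bounded 0) (sumBelow-≤ m (f ∘ suc) (bounded ∘ suc))

+-saturated : ∀ {a b m} → a ≤ 1 → b ≤ m → a + b ≡ suc m → a ≡ 1 × b ≡ m
+-saturated z≤n b≤m refl = contradiction b≤m 1+n≰n
+-saturated (s≤s z≤n) _ sum≡ = refl , suc-injective sum≡

sumBelow-saturated : ∀ m f → (∀ j → f j ≤ 1) → sumBelow m f ≡ m → ∀ j → j < m → f j ≡ 1
sumBelow-saturated (suc m) f bounded total = λ
  { zero _ → proj₁ split
  ; (suc j) (s≤s j<m) → sumBelow-saturated m (f ∘ suc) (bounded ∘ suc) (proj₂ split) j j<m }
  where
  split : f 0 ≡ 1 × sumBelow m (f ∘ suc) ≡ m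
  split = +-saturated (bounded 0) (sumBelow-≤ m (f ∘ suc) (bounded ∘ suc)) total

extend : ∀ {m} {A : Set} → (Fin m → A) → A → ℕ → A
extend {zero} f d i = d
extend {suc m} f d zero = f fzero
extend {suc m} f d (suc i) = extend (f ∘ fsuc) d i

extend-toℕ : ∀ {m} {A : Set} (f : Fin m → A) d (i : Fin m) → extend f d (toℕ i) ≡ f i
extend-toℕ f d fzero = refl
extend-toℕ f d (fsuc i) = extend-toℕ (f ∘ fsuc) d i

extend-true⁻ : ∀ {m} (f : Fin m → Bool) c → extend f false c ≡ true → Σ[ i ∈ Fin m ] toℕ i ≡ c × f i ≡ true
extend-true⁻ {suc m} f zero fi = fzero , refl , fi
extend-true⁻ {suc m} f (suc c) fi with extend-true⁻ (f ∘ fsuc) c fi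
... | i , refl , fi′ = fsuc i , refl , fi′

length-filterᵇ-++ : ∀ {A : Set} (g : A → Bool) xs ys →
  length (filterᵇ g (xs ++ ys)) ≡ length (filterᵇ g xs) + length (filterᵇ g ys)
length-filterᵇ-++ g xs ys = trans (cong length (filter-++ (T? ∘ g) xs ys)) (length-++ (filterᵇ g xs))

length-filterᵇ-tabulate : ∀ {m} {A : Set} (g : A → Bool) (h : Fin m → A) →
  length (filterᵇ g (List.tabulate h)) ≡ sumBelow m (bit ∘ extend (g ∘ h) false)
length-filterᵇ-tabulate {zero} g h = refl
length-filterᵇ-tabulate {suc m} g h with g (h fzero)
... | true = cong suc (length-filterᵇ-tabulate g (h ∘ fsuc))
... | false = length-filterᵇ-tabulate g (h ∘ fsuc)

-- A 2 × 2 block of cells, indexed by the row and by whether the column is the left one.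
Block : Set
Block = Bool → Bool → Bool

blockCount : Block → ℕ
blockCount s = bit (s true true) + bit (s false true) + (bit (s true false) + bit (s false false))

topOccupied leftOccupied : Block → Bool
topOccupied s = s true true ∨ s true false
leftOccupied s = s true true ∨ s false true

blockCount≤1 : (s : Block) → (∀ r b r′ b′ → (r , b) ≢ (r′ , b′) → s r b ≡ true → s r′ b′ ≡ true → ⊥) →
  blockCount s ≤ 1
blockCount≤1 s excl with s true true in tt | s false true in ft | s true false in tf | s false false in ff
... | true | true | _ | _ = ⊥-elim (excl true true false true (λ ()) tt ft)
... | true | false | true | _ = ⊥-elim (excl true true true false (λ ()) tt tf)
... | true | false | false | true = ⊥-elim (excl true true false false (λ ()) tt ff)
... | true | false | false | false = ≤-refl
... | false | true | true | _ = ⊥-elim (excl false true true false (λ ()) ft tf)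
... | false | true | false | true = ⊥-elim (excl false true false false (λ ()) ft ff)
... | false | true | false | false = ≤-refl
... | false | false | true | true = ⊥-elim (excl true false false false (λ ()) tf ff)
... | false | false | true | false = ≤-refl
... | false | false | false | true = ≤-refl
... | false | false | false | false = z≤n

blockCount≡1⇒indicator : (s : Block) → blockCount s ≡ 1 → ∀ r b → s r b ≡ ⌊ r ≟ topOccupied s ⌋ ∧ ⌊ b ≟ leftOccupied s ⌋
blockCount≡1⇒indicator s one with s true true in tt | s false true in ft | s true false in tf | s false false in ff
... | true | false | false | false = λ { true true → tt ; false true → ft ; true false → tf ; false false → ff }
... | false | true | false | false = λ { true true → tt ; false true → ft ; true false → tf ; false false → ff }
... | false | false | true | false = λ { true true → tt ; false true → ft ; true false → tf ; false false → ff }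
... | false | false | false | true = λ { true true → tt ; false true → ft ; true false → tf ; false false → ff }

AntitoneBelow : ℕ → (ℕ → Bool) → Set
AntitoneBelow n f = ∀ j → suc j < n → f (suc j) ≡ true → f j ≡ true

antitone⇒threshold : ∀ n f → AntitoneBelow n f → Σ[ k ∈ Fin (suc n) ] (∀ j → j < n → f j ≡ (j <ᵇ toℕ k))
antitone⇒threshold zero f _ = fzero , λ _ ()
antitone⇒threshold (suc n) f antitone
  with antitone⇒threshold n (f ∘ suc) (λ j j<n → antitone (suc j) (s≤s j<n)) | f 0 in f0
... | k , f∘suc≡ | true = fsuc k , λ { zero _ → f0 ; (suc j) (s≤s j<n) → f∘suc≡ j j<n }
... | fzero , f∘suc≡ | false = fzero , λ { zero _ → f0 ; (suc j) (s≤s j<n) → f∘suc≡ j j<n }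
... | fsuc k , f∘suc≡ | false = case trans (sym f0) (antitone 0 (s≤s 0<n) (f∘suc≡ 0 0<n)) of λ ()
  where
  0<n : 0 < n
  0<n = ≤-trans (s≤s z≤n) (toℕ<n k)

threshold-unique : ∀ {n} (k k′ : Fin (suc n)) → (∀ (j : Fin n) → (toℕ j <ᵇ toℕ k) ≡ (toℕ j <ᵇ toℕ k′)) → k ≡ k′
threshold-unique fzero fzero _ = refl
threshold-unique {suc n} fzero (fsuc k′) same = case same fzero of λ ()
threshold-unique {suc n} (fsuc k) fzero same = case same fzero of λ ()
threshold-unique {suc n} (fsuc k) (fsuc k′) same = cong fsuc (threshold-unique k k′ (same ∘ fsuc))

squareColumn : Bool → ℕ → ℕ
squareColumn true j = j * 2
squareColumn false j = suc (j * 2)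

squareColumn-/2 : ∀ b j → squareColumn b j / 2 ≡ j
squareColumn-/2 true j = m*n/n≡m j 2
squareColumn-/2 false j = trans (+-distrib-/-∣ʳ 1 {d = 2} (n∣m*n j)) (m*n/n≡m j 2)

squareColumn-even : ∀ b j → ⌊ squareColumn b j % 2 ≟ℕ 0 ⌋ ≡ b
squareColumn-even true j = cong (λ m → ⌊ m ≟ℕ 0 ⌋) (m*n%n≡0 j 2)
squareColumn-even false j = cong (λ m → ⌊ m ≟ℕ 0 ⌋) ([m+kn]%n≡m%n 1 j 2)

squareColumn-injective : ∀ {b b′} j → squareColumn b j ≡ squareColumn b′ j → b ≡ b′
squareColumn-injective {true} {true} j _ = refl
squareColumn-injective {true} {false} j eq = contradiction (sym eq) 1+n≢n
squareColumn-injective {false} {true} j eq = contradiction eq 1+n≢n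
squareColumn-injective {false} {false} j _ = refl

squareColumn-near : ∀ b b′ j → colNear (squareColumn b j) (squareColumn b′ j)
squareColumn-near true true j = inj₁ refl
squareColumn-near true false j = inj₂ (inj₁ refl)
squareColumn-near false true j = inj₂ (inj₂ refl)
squareColumn-near false false j = inj₁ refl

squareColumn-< : ∀ {n} b j → j < n → squareColumn b j < 2 * n
squareColumn-< {n} b j j<n = subst (squareColumn b j <_) (*-comm n 2) (≤-trans (below b) (*-monoˡ-≤ 2 j<n))
  where
  below : ∀ b → squareColumn b j < suc j * 2
  below true = s≤s (n≤1+n (j * 2))
  below false = ≤-refl

squareCell : ∀ {n} → Bool → Fin n → Fin (2 * n)
squareCell b j = fromℕ< (squareColumn-< b (toℕ j) (toℕ<n j))

toℕ-squareCell : ∀ {n} b (j : Fin n) → toℕ (squareCell b j) ≡ squareColumn b (toℕ j)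
toℕ-squareCell b j = toℕ-fromℕ< (squareColumn-< b (toℕ j) (toℕ<n j))

column-decomposition : ∀ {n} (c : Fin (2 * n)) → Σ[ b ∈ Bool ] Σ[ j ∈ Fin n ] toℕ c ≡ squareColumn b (toℕ j)
column-decomposition {n} c = parity (toℕ c % 2) (m≡m%n+[m/n]*n (toℕ c) 2) (m%n<n (toℕ c) 2)
  where
  half<n : toℕ c / 2 < n
  half<n = m<n*o⇒m/o<n (subst (toℕ c <_) (*-comm 2 n) (toℕ<n c))
  j : Fin n
  j = fromℕ< half<n
  parity : ∀ r → toℕ c ≡ r + toℕ c / 2 * 2 → r < 2 → Σ[ b ∈ Bool ] Σ[ j ∈ Fin n ] toℕ c ≡ squareColumn b (toℕ j)
  parity 0 c≡ _ = true , j , trans c≡ (cong (squareColumn true) (sym (toℕ-fromℕ< half<n)))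
  parity 1 c≡ _ = false , j , trans c≡ (cong (squareColumn false) (sym (toℕ-fromℕ< half<n)))
  parity (suc (suc _)) _ (s≤s (s≤s ()))

-- Columns are read as natural numbers; columns off the board are empty.
occupied : ∀ {m} → (Bool × Fin m → Bool) → Bool → ℕ → Bool
occupied P r = extend (λ c → P (r , c)) false

square : ∀ {m} → (Bool × Fin m → Bool) → ℕ → Block
square P j r b = occupied P r (squareColumn b j)

numKings≡sum-blockCount : ∀ {n} (P : Placement n) → numKings {n} P ≡ sumBelow n (blockCount ∘ square P)
numKings≡sum-blockCount {n} P = begin
  numKings {n} P
    ≡⟨ length-filterᵇ-++ P (row true) (row false ++ List.[]) ⟩
  length (filterᵇ P (row true)) + length (filterᵇ P (row false ++ List.[]))
    ≡⟨ cong (λ xs → length (filterᵇ P (row true)) + length (filterᵇ P xs)) (++-identityʳ (row false)) ⟩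
  length (filterᵇ P (row true)) + length (filterᵇ P (row false))
    ≡⟨ cong₂ _+_ (kingsInRow true) (kingsInRow false) ⟩
  sumBelow (2 * n) (bit ∘ occupied P true) + sumBelow (2 * n) (bit ∘ occupied P false)
    ≡⟨ sumBelow-+ (2 * n) _ _ ⟩
  sumBelow (2 * n) kingsInColumn
    ≡⟨ cong (λ m → sumBelow m kingsInColumn) (*-comm 2 n) ⟩
  sumBelow (n * 2) kingsInColumn
    ≡⟨ sumBelow-pairs n kingsInColumn ⟩
  sumBelow n (blockCount ∘ square P)
    ∎
  where
  open ≡-Reasoning
  row : Bool → List (Cell n)
  row r = map (r ,_) (List.allFin (2 * n))
  kingsInRow : ∀ r → length (filterᵇ P (row r)) ≡ sumBelow (2 * n) (bit ∘ occupied P r)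
  kingsInRow r = trans (cong (length ∘ filterᵇ P) (map-tabulate {n = 2 * n} id (r ,_)))
                       (length-filterᵇ-tabulate {2 * n} P (r ,_))
  kingsInColumn : ℕ → ℕ
  kingsInColumn c = bit (occupied P true c) + bit (occupied P false c)

occupied-nonattacking : ∀ {n} {P : Placement n} → NonAttacking {n} P → ∀ {r r′ c c′} →
  occupied P r c ≡ true → occupied P r′ c′ ≡ true → colNear c c′ → (r , c) ≡ (r′ , c′)
occupied-nonattacking {n} {P} nonattacking {r} {r′} {c} {c′} occ occ′ near
  with extend-true⁻ {2 * n} (λ c → P (r , c)) c occ | extend-true⁻ {2 * n} (λ c → P (r′ , c)) c′ occ′
... | i , refl , Pi | i′ , refl , Pi′ with ≡-dec _≟_ _≟ᶠ_ (r , i) (r′ , i′)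
...   | yes refl = refl
...   | no distinct = ⊥-elim (nonattacking (r , i) (r′ , i′) Pi Pi′ (distinct , near))

R-at : ∀ {n} (A : Subset n) (k : Fin (suc n)) r {b} (j : Fin n) {c : Fin (2 * n)} →
  toℕ c ≡ squareColumn b (toℕ j) → R A k (r , c) ≡ ⌊ r ≟ lookup A j ⌋ ∧ ⌊ b ≟ (toℕ j <ᵇ toℕ k) ⌋
R-at {n} A k r {b} j {c} c≡ with half ← trans (cong (_/ 2) c≡) (squareColumn-/2 b (toℕ j)) | toℕ c / 2 <? n
... | yes c/2<n = cong₂ _∧_
  (cong (λ i → ⌊ r ≟ lookup A i ⌋) (trans (fromℕ<-cong _ _ half c/2<n (toℕ<n j)) (fromℕ<-toℕ j _)))
  (cong₂ (λ x y → ⌊ x ≟ y ⌋)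
    (trans (cong (λ m → ⌊ m % 2 ≟ℕ 0 ⌋) c≡) (squareColumn-even b (toℕ j)))
    (trans (isYes≗does (toℕ c / 2 <? toℕ k)) (cong (_<ᵇ toℕ k) half)))
... | no c/2≮n = contradiction (subst (_< n) (sym half) (toℕ<n j)) c/2≮n

R-injective : ∀ {n} {A A′ : Subset n} {k k′ : Fin (suc n)} → (∀ c → R A k c ≡ R A′ k′ c) → A ≡ A′ × k ≡ k′
R-injective {n} {A} {A′} {k} {k′} same =
  Pointwise-≡⇒≡ (ext (proj₁ ∘ agree)) , threshold-unique k k′ (proj₂ ∘ agree)
  where
  agree : ∀ j → lookup A j ≡ lookup A′ j × (toℕ j <ᵇ toℕ k) ≡ (toℕ j <ᵇ toℕ k′)
  agree j = Product.map (≟-sound _ _) (≟-sound _ _) (∧-true⁻ (begin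
    ⌊ lookup A j ≟ lookup A′ j ⌋ ∧ ⌊ (toℕ j <ᵇ toℕ k) ≟ (toℕ j <ᵇ toℕ k′) ⌋
      ≡⟨ sym (R-at A′ k′ (lookup A j) j c≡) ⟩
    R A′ k′ (lookup A j , c)
      ≡⟨ sym (same (lookup A j , c)) ⟩
    R A k (lookup A j , c)
      ≡⟨ R-at A k (lookup A j) j c≡ ⟩
    ⌊ lookup A j ≟ lookup A j ⌋ ∧ ⌊ (toℕ j <ᵇ toℕ k) ≟ (toℕ j <ᵇ toℕ k) ⌋
      ≡⟨ cong₂ _∧_ (≟-refl (lookup A j)) (≟-refl (toℕ j <ᵇ toℕ k)) ⟩
    true
      ∎))
    where
    open ≡-Reasoning
    c : Fin (2 * n)
    c = squareCell (toℕ j <ᵇ toℕ k) j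
    c≡ : toℕ c ≡ squareColumn (toℕ j <ᵇ toℕ k) (toℕ j)
    c≡ = toℕ-squareCell (toℕ j <ᵇ toℕ k) j

blockCount≤1-square : ∀ {n} {P : Placement n} → NonAttacking {n} P → ∀ j → blockCount (square P j) ≤ 1
blockCount≤1-square {n} {P} nonattacking j = blockCount≤1 (square P j) λ r b r′ b′ distinct occ occ′ →
  let same = occupied-nonattacking {n} {P} nonattacking occ occ′ (squareColumn-near b b′ j)
  in distinct (cong₂ _,_ (cong proj₁ same) (squareColumn-injective j (cong proj₂ same)))

module ValidPlacementStructure {n : ℕ} {P : Placement n}
  (n-kings : numKings {n} P ≡ n) (nonattacking : NonAttacking {n} P) where

  kingRow kingOnLeft : ℕ → Bool
  kingRow = topOccupied ∘ square P
  kingOnLeft = leftOccupied ∘ square P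

  square-shape : ∀ j → j < n → ∀ r b → square P j r b ≡ ⌊ r ≟ kingRow j ⌋ ∧ ⌊ b ≟ kingOnLeft j ⌋
  square-shape j j<n = blockCount≡1⇒indicator (square P j) (oneKing j j<n)
    where
    oneKing : ∀ j → j < n → blockCount (square P j) ≡ 1
    oneKing = sumBelow-saturated n (blockCount ∘ square P) (blockCount≤1-square {n} {P} nonattacking)
                (trans (sym (numKings≡sum-blockCount {n} P)) n-kings)

  king : ∀ j → j < n → square P j (kingRow j) (kingOnLeft j) ≡ true
  king j j<n = trans (square-shape j j<n _ _) (cong₂ _∧_ (≟-refl (kingRow j)) (≟-refl (kingOnLeft j)))

  kingOnLeft-antitone : AntitoneBelow n kingOnLeft
  kingOnLeft-antitone j 1+j<n nextLeft with kingOnLeft j in hereLeft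
  ... | true = refl
  ... | false = contradiction (cong proj₂ clash) (1+n≢n ∘ sym)
    where
    here : square P j (kingRow j) false ≡ true
    here = subst (λ l → square P j (kingRow j) l ≡ true) hereLeft (king j (≤-trans (n≤1+n _) 1+j<n))
    next : square P (suc j) (kingRow (suc j)) true ≡ true
    next = subst (λ l → square P (suc j) (kingRow (suc j)) l ≡ true) nextLeft (king (suc j) 1+j<n)
    -- A right-column king in square j and a left-column king in square j+1 are in adjacent columns.
    clash : (kingRow j , suc (j * 2)) ≡ (kingRow (suc j) , suc (suc (j * 2)))
    clash = occupied-nonattacking {n} {P} nonattacking here next (inj₂ (inj₁ refl))

  kingRows : Subset n
  kingRows = tabulate (kingRow ∘ toℕ)

  leftBoundary : Fin (suc n)
  leftBoundary = proj₁ (antitone⇒threshold n kingOnLeft kingOnLeft-antitone)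

  kingOnLeft≡threshold : ∀ j → j < n → kingOnLeft j ≡ (j <ᵇ toℕ leftBoundary)
  kingOnLeft≡threshold = proj₂ (antitone⇒threshold n kingOnLeft kingOnLeft-antitone)

  placement≗R : ∀ c → P c ≡ R kingRows leftBoundary c
  placement≗R (r , c) with column-decomposition c
  ... | b , j , c≡ = begin
    P (r , c)
      ≡⟨ sym (extend-toℕ (λ c → P (r , c)) false c) ⟩
    occupied P r (toℕ c)
      ≡⟨ cong (occupied P r) c≡ ⟩
    square P (toℕ j) r b
      ≡⟨ square-shape (toℕ j) (toℕ<n j) r b ⟩
    ⌊ r ≟ kingRow (toℕ j) ⌋ ∧ ⌊ b ≟ kingOnLeft (toℕ j) ⌋
      ≡⟨ cong₂ (λ x y → ⌊ r ≟ x ⌋ ∧ ⌊ b ≟ y ⌋) (sym (lookup∘tabulate _ j)) (kingOnLeft≡threshold (toℕ j) (toℕ<n j)) ⟩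
    ⌊ r ≟ lookup kingRows j ⌋ ∧ ⌊ b ≟ (toℕ j <ᵇ toℕ leftBoundary) ⌋
      ≡⟨ sym (R-at kingRows leftBoundary r j c≡) ⟩
    R kingRows leftBoundary (r , c)
      ∎
    where open ≡-Reasoning

lemma1 : (n : ℕ) → n ≥ 1 → (P : Placement n) → ValidPlacement n P →
    Σ (Subset n × Fin (suc n)) λ { (A , k) →
    (∀ c → P c ≡ R A k c) ×
    (∀ (A′ : Subset n) (k′ : Fin (suc n)) →
    (∀ c → P c ≡ R A′ k′ c) → (A′ ≡ A) × (k′ ≡ k)) }
-- The argument does not need n ≥ 1.
lemma1 n _ P (n-kings , nonattacking) = (kingRows , leftBoundary) , placement≗R , λ A′ k′ P≗R′ →
  R-injective {A = A′} {kingRows} {k′} {leftBoundary} (λ c → trans (sym (P≗R′ c)) (placement≗R c))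
  where open ValidPlacementStructure {n} n-kings nonattacking
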